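{- For $n\ge 0$ let $a_n=[x^n]\,(1-x)^{ -n}(1-x^2)^{ -n}$ and let $g(z)=\sum_{n\ge0}a_nz^n$ (so $g(z)=1+z+5z^2+19z^3+85z^4+\cdots$). Let $s(z)=1+z+3z^2+9z^3+\cdots$ be the unique formal power series with $s(0)=1$ satisfying $z^3s^4-z^2s^3-zs^2+s-1=0$. Then $$g(z)=\frac{1-s(z)^2z^2}{1-z\,s(z)-4z^2s(z)^2},$$ and $g$ satisfies the algebraic equation $$(256z^2+107z-32)g^4+(-256z^2-107z+32)g^3+12z(8z+3)g^2-4z(4z+1)g+z^2=0.$$
   Context: $[x^n]h(x)$ denotes the coefficient of $x^n$ in the power series $h(x)$. The sequence $(a_n)$ is A348410 in the On-Line Encyclopedia of Integer Sequences. -}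

module Defs where

open import Data.Nat using (ℕ; zero; suc; _∸_)
open import Data.Integer using (ℤ; +_; _+_; _*_; -_)
open import Relation.Binary.PropositionalEquality using (_≡_)

Series : Set
Series = ℕ → ℤ

infix 4 _≈ₛ_
_≈ₛ_ : Series → Series → Set
f ≈ₛ g = ∀ n → f n ≡ g n

cst : ℤ → Series
cst c zero    = c
cst c (suc _) = + 0

X : Series
X (suc zero) = + 1
X _          = + 0

infixl 6 _⊕_ _⊖_
infixl 7 _⊗_ _·_
infixr 8 _^ₛ_

_⊕_ : Series → Series → Series
(f ⊕ g) n = f n + g n

⊝_ : Series → Series
(⊝ f) n = - f n

_⊖_ : Series → Series → Series
f ⊖ g = f ⊕ (⊝ g)

_·_ : ℤ → Series → Series
(c · f) n = c * f n

convUpTo : Series → Series → ℕ → ℕ → ℤ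
convUpTo f g n zero    = f 0 * g n
convUpTo f g n (suc k) = convUpTo f g n k + f (suc k) * g (n ∸ suc k)

_⊗_ : Series → Series → Series
(f ⊗ g) n = convUpTo f g n n

_^ₛ_ : Series → ℕ → Series
f ^ₛ zero  = cst (+ 1)
f ^ₛ suc k = f ⊗ (f ^ₛ k)

invOneMinusX : Series
invOneMinusX _ = + 1

invOneMinusX² : Series
invOneMinusX² zero          = + 1
invOneMinusX² (suc zero)    = + 0
invOneMinusX² (suc (suc k)) = invOneMinusX² k

a : ℕ → ℤ
a n = ((invOneMinusX ^ₛ n) ⊗ (invOneMinusX² ^ₛ n)) n

g : Series
g = a

-- Let Φ = 1/((1-x)(1-x²)) = 1/P and Λ k = Σₙ [xⁿ] Φ^(k+n) zⁿ, so that g = Λ 0. Multiplying Φ^(N+1)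
-- by P = 1 - x - x² + x³ shows that Λ satisfies Λ (k+1) = Λ k + z Λ (k+2) + z² Λ (k+3) - z³ Λ (k+4).
-- When s is a root of the quartic, the family g sᵏ satisfies the same recurrence, and a solution is
-- determined by its first member, so Λ k = g sᵏ. Lagrange's observation
-- n [xⁿ] Φⁿ = [xⁿ] x (Φⁿ)′ = -n [xⁿ] Φ^(n+1) x P′ gives g = 1 + z Λ 2 + 2 z² Λ 3 - 3 z³ Λ 4, that is
-- g (1 + s w P′(w)) = 1 with w = z s. As s P(w) = 1, P(w) = (1-w)(1-w²) and
-- P(w) + w P′(w) = (1-w)(1-w-4w²), this says g = (1-w²)/(1-w-4w²); eliminating s gives the quartic
-- equation of g. The root s is the fixed point of the contraction t ↦ 1 + z (t² + z (t³ - z t⁴)).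
module Submission where

open import Defs
open import Algebra.Solver.Ring.AlmostCommutativeRing
  using (AlmostCommutativeRing; _-Raw-AlmostCommutative⟶_)
open import Algebra.Structures _≈ₛ_ using (IsCommutativeMonoid)
open import Algebra.Structures.Biased _≈ₛ_ using (isCommutativeSemiringˡ)
open import Data.Integer as ℤ using (ℤ; +_; -_; _+_; _*_)
import Data.Integer.Properties as ℤP
open import Data.Integer.Solver using (module +-*-Solver)
open import Data.Maybe using (Maybe; just; nothing)
open import Data.Nat as ℕ using (ℕ; zero; suc; _∸_; _≤_; _<_; z≤n; s≤s)
import Data.Nat.Properties as ℕP
open import Data.Product using (Σ; _×_; _,_)
open import Data.Sum using (inj₁; inj₂)
open import Relation.Binary.PropositionalEquality
  using (_≡_; refl; sym; trans; cong; cong₂; module ≡-Reasoning)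
import Relation.Binary.Reasoning.Setoid
open import Relation.Binary.Structures using (IsEquivalence)
open import Relation.Nullary using (yes; no)
open import Algebra.Properties.CommutativeSemigroup ℤP.+-commutativeSemigroup
  using (interchange)

shift : Series → Series
shift f n = f (suc n)

convUpTo-cong : ∀ {f f′ h h′} → f ≈ₛ f′ → h ≈ₛ h′ →
                ∀ n k → convUpTo f h n k ≡ convUpTo f′ h′ n k
convUpTo-cong f≈ h≈ n zero    = cong₂ _*_ (f≈ 0) (h≈ n)
convUpTo-cong f≈ h≈ n (suc k) =
  cong₂ _+_ (convUpTo-cong f≈ h≈ n k) (cong₂ _*_ (f≈ (suc k)) (h≈ (n ∸ suc k)))

⊗-cong : ∀ {f f′ h h′} → f ≈ₛ f′ → h ≈ₛ h′ → f ⊗ h ≈ₛ f′ ⊗ h′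
⊗-cong f≈ h≈ n = convUpTo-cong f≈ h≈ n n

convUpTo-shiftˡ : ∀ f h n k →
                  convUpTo f h (suc n) (suc k) ≡ f 0 * h (suc n) + convUpTo (shift f) h n k
convUpTo-shiftˡ f h n zero    = refl
convUpTo-shiftˡ f h n (suc k) =
  trans (cong (_+ f (suc (suc k)) * h (n ∸ suc k)) (convUpTo-shiftˡ f h n k))
        (ℤP.+-assoc (f 0 * h (suc n)) _ _)

⊗-shiftˡ : ∀ f h n → (f ⊗ h) (suc n) ≡ f 0 * h (suc n) + (shift f ⊗ h) n
⊗-shiftˡ f h n = convUpTo-shiftˡ f h n n

convUpTo-shiftʳ : ∀ f h {n} k → k ≤ n → convUpTo f h (suc n) k ≡ convUpTo f (shift h) n k
convUpTo-shiftʳ f h zero    _   = refl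
convUpTo-shiftʳ f h (suc k) k<n =
  cong₂ _+_ (convUpTo-shiftʳ f h k (ℕP.<⇒≤ k<n))
            (cong (λ j → f (suc k) * h j) (ℕP.+-∸-assoc 1 k<n))

⊗-shiftʳ : ∀ f h n → (f ⊗ h) (suc n) ≡ (f ⊗ shift h) n + f (suc n) * h 0
⊗-shiftʳ f h n = cong₂ _+_ (convUpTo-shiftʳ f h n ℕP.≤-refl)
                           (cong (λ j → f (suc n) * h j) (ℕP.n∸n≡0 n))

⊗-comm : ∀ f h → f ⊗ h ≈ₛ h ⊗ f
⊗-comm f h zero    = ℤP.*-comm (f 0) (h 0)
⊗-comm f h (suc n) = begin
  (f ⊗ h) (suc n)                    ≡⟨ ⊗-shiftˡ f h n ⟩
  f 0 * h (suc n) + (shift f ⊗ h) n  ≡⟨ cong₂ _+_ (ℤP.*-comm (f 0) _) (⊗-comm (shift f) h n) ⟩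
  h (suc n) * f 0 + (h ⊗ shift f) n  ≡⟨ ℤP.+-comm (h (suc n) * f 0) _ ⟩
  (h ⊗ shift f) n + h (suc n) * f 0  ≡⟨ ⊗-shiftʳ h f n ⟨
  (h ⊗ f) (suc n)                    ∎
  where open ≡-Reasoning

convUpTo-⊕ˡ : ∀ f₁ f₂ h n k →
              convUpTo (f₁ ⊕ f₂) h n k ≡ convUpTo f₁ h n k + convUpTo f₂ h n k
convUpTo-⊕ˡ f₁ f₂ h n zero    = ℤP.*-distribʳ-+ (h n) (f₁ 0) (f₂ 0)
convUpTo-⊕ˡ f₁ f₂ h n (suc k) =
  trans (cong₂ _+_ (convUpTo-⊕ˡ f₁ f₂ h n k) (ℤP.*-distribʳ-+ _ (f₁ (suc k)) (f₂ (suc k))))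
        (interchange (convUpTo f₁ h n k) (convUpTo f₂ h n k) _ _)

convUpTo-·ˡ : ∀ c f h n k → convUpTo (c · f) h n k ≡ c * convUpTo f h n k
convUpTo-·ˡ c f h n zero    = ℤP.*-assoc c (f 0) (h n)
convUpTo-·ˡ c f h n (suc k) =
  trans (cong₂ _+_ (convUpTo-·ˡ c f h n k) (ℤP.*-assoc c (f (suc k)) _))
        (sym (ℤP.*-distribˡ-+ c _ _))

convUpTo-⊝ˡ : ∀ f h n k → convUpTo (⊝ f) h n k ≡ - convUpTo f h n k
convUpTo-⊝ˡ f h n zero    = sym (ℤP.neg-distribˡ-* (f 0) (h n))
convUpTo-⊝ˡ f h n (suc k) =
  trans (cong₂ _+_ (convUpTo-⊝ˡ f h n k) (sym (ℤP.neg-distribˡ-* (f (suc k)) _)))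
        (sym (ℤP.neg-distrib-+ (convUpTo f h n k) _))

convUpTo-zeroˡ : ∀ h n k → convUpTo (λ _ → + 0) h n k ≡ + 0
convUpTo-zeroˡ h n zero    = refl
convUpTo-zeroˡ h n (suc k) = trans (ℤP.+-identityʳ _) (convUpTo-zeroˡ h n k)

⊗-distribʳ-⊕ : ∀ h f₁ f₂ → (f₁ ⊕ f₂) ⊗ h ≈ₛ f₁ ⊗ h ⊕ f₂ ⊗ h
⊗-distribʳ-⊕ h f₁ f₂ n = convUpTo-⊕ˡ f₁ f₂ h n n

·-⊗ : ∀ c f h → (c · f) ⊗ h ≈ₛ c · (f ⊗ h)
·-⊗ c f h n = convUpTo-·ˡ c f h n n

⊝-⊗ : ∀ f h → (⊝ f) ⊗ h ≈ₛ ⊝ (f ⊗ h)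
⊝-⊗ f h n = convUpTo-⊝ˡ f h n n

cst-⊗ : ∀ c f → cst c ⊗ f ≈ₛ c · f
cst-⊗ c f zero    = refl
cst-⊗ c f (suc n) =
  trans (⊗-shiftˡ (cst c) f n) (trans (cong (_+_ (c * f (suc n))) (convUpTo-zeroˡ f n n))
                                      (ℤP.+-identityʳ _))

⊗-assoc : ∀ f h k → (f ⊗ h) ⊗ k ≈ₛ f ⊗ (h ⊗ k)
⊗-assoc f h k zero    = ℤP.*-assoc (f 0) (h 0) (k 0)
⊗-assoc f h k (suc n) = begin
  ((f ⊗ h) ⊗ k) (suc n)
    ≡⟨ ⊗-shiftˡ (f ⊗ h) k n ⟩
  f 0 * h 0 * k (suc n) + (shift (f ⊗ h) ⊗ k) n
    ≡⟨ cong (_+_ (f 0 * h 0 * k (suc n))) (begin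
         (shift (f ⊗ h) ⊗ k) n                       ≡⟨ ⊗-cong (⊗-shiftˡ f h) (λ _ → refl) n ⟩
         ((f 0 · shift h ⊕ shift f ⊗ h) ⊗ k) n       ≡⟨ ⊗-distribʳ-⊕ k (f 0 · shift h) _ n ⟩
         ((f 0 · shift h) ⊗ k) n + ((shift f ⊗ h) ⊗ k) n
           ≡⟨ cong₂ _+_ (·-⊗ (f 0) (shift h) k n) (⊗-assoc (shift f) h k n) ⟩
         f 0 * (shift h ⊗ k) n + (shift f ⊗ (h ⊗ k)) n ∎) ⟩
  f 0 * h 0 * k (suc n) + (f 0 * (shift h ⊗ k) n + (shift f ⊗ (h ⊗ k)) n)
    ≡⟨ solve 5 (λ a b c d e → a :* b :* c :+ (a :* d :+ e) := a :* (b :* c :+ d) :+ e) refl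
         (f 0) (h 0) (k (suc n)) ((shift h ⊗ k) n) ((shift f ⊗ (h ⊗ k)) n) ⟩
  f 0 * (h 0 * k (suc n) + (shift h ⊗ k) n) + (shift f ⊗ (h ⊗ k)) n
    ≡⟨ cong (λ t → f 0 * t + (shift f ⊗ (h ⊗ k)) n) (⊗-shiftˡ h k n) ⟨
  f 0 * (h ⊗ k) (suc n) + (shift f ⊗ (h ⊗ k)) n
    ≡⟨ ⊗-shiftˡ f (h ⊗ k) n ⟨
  (f ⊗ (h ⊗ k)) (suc n) ∎
  where open ≡-Reasoning
        open +-*-Solver

-- The Euler operator z d/dz

δ : Series → Series
δ f n = + n * f n

leibniz-weight : ∀ {n} i a b → i ≤ n → + n * (a * b) ≡ + i * a * b + a * (+ (n ∸ i) * b)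
leibniz-weight {n} i a b i≤n = begin
  + n * (a * b)                      ≡⟨ cong (λ m → + m * (a * b)) (ℕP.m+[n∸m]≡n i≤n) ⟨
  + (i ℕ.+ (n ∸ i)) * (a * b)        ≡⟨ cong (_* (a * b)) (ℤP.pos-+ i (n ∸ i)) ⟩
  (+ i + + (n ∸ i)) * (a * b)        ≡⟨ solve 4 (λ x y a b → (x :+ y) :* (a :* b) := x :* a :* b :+ a :* (y :* b))
                                            refl (+ i) (+ (n ∸ i)) a b ⟩
  + i * a * b + a * (+ (n ∸ i) * b)  ∎
  where open ≡-Reasoning
        open +-*-Solver

convUpTo-δ : ∀ f h {n} k → k ≤ n →
             + n * convUpTo f h n k ≡ convUpTo (δ f) h n k + convUpTo f (δ h) n k
convUpTo-δ f h {n} zero _ = leibniz-weight {n} 0 (f 0) (h n) z≤n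
convUpTo-δ f h {n} (suc k) k<n =
  trans (ℤP.*-distribˡ-+ (+ n) (convUpTo f h n k) _)
        (trans (cong₂ _+_ (convUpTo-δ f h k (ℕP.<⇒≤ k<n)) (leibniz-weight {n} (suc k) (f (suc k)) _ k<n))
               (interchange (convUpTo (δ f) h n k) (convUpTo f (δ h) n k) _ _))

δ-⊗ : ∀ f h → δ (f ⊗ h) ≈ₛ δ f ⊗ h ⊕ f ⊗ δ h
δ-⊗ f h n = convUpTo-δ f h n ℕP.≤-refl

δ-cong : ∀ {f h} → f ≈ₛ h → δ f ≈ₛ δ h
δ-cong f≈h n = cong (+ n *_) (f≈h n)

δ-cst : ∀ c → δ (cst c) ≈ₛ cst (+ 0)
δ-cst c zero    = refl
δ-cst c (suc n) = ℤP.*-zeroʳ (+ suc n)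

δ-cst⊖ : ∀ c f → δ (cst c ⊖ f) ≈ₛ ⊝ δ f
δ-cst⊖ c f zero    = refl
δ-cst⊖ c f (suc n) =
  trans (cong (+ suc n *_) (ℤP.+-identityˡ _)) (sym (ℤP.neg-distribʳ-* (+ suc n) (f (suc n))))

δ-cst⊕ : ∀ c f → δ (cst c ⊕ f) ≈ₛ δ f
δ-cst⊕ c f zero    = refl
δ-cst⊕ c f (suc n) = cong (+ suc n *_) (ℤP.+-identityˡ _)

δ-X : δ X ≈ₛ X
δ-X zero          = refl
δ-X (suc zero)    = refl
δ-X (suc (suc n)) = ℤP.*-zeroʳ (+ suc (suc n))

δ-injective : ∀ {f h} → f 0 ≡ h 0 → δ f ≈ₛ δ h → f ≈ₛ h
δ-injective f₀≡h₀ _   zero    = f₀≡h₀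
δ-injective _     δ≈ (suc n) = ℤP.*-cancelˡ-≡ (+ suc n) _ _ (δ≈ (suc n))

cst-zero : ∀ n → cst (+ 0) n ≡ + 0
cst-zero zero    = refl
cst-zero (suc n) = refl

≈ₛ-isEquivalence : IsEquivalence _≈ₛ_
≈ₛ-isEquivalence = record
  { refl  = λ _ → refl
  ; sym   = λ f≈h n → sym (f≈h n)
  ; trans = λ f≈h h≈k n → trans (f≈h n) (h≈k n)
  }

⊕-isCommutativeMonoid : IsCommutativeMonoid _⊕_ (cst (+ 0))
⊕-isCommutativeMonoid = record
  { isMonoid = record
    { isSemigroup = record
      { isMagma = record
        { isEquivalence = ≈ₛ-isEquivalence
        ; ∙-cong        = λ f≈ h≈ n → cong₂ _+_ (f≈ n) (h≈ n)
        }
      ; assoc = λ f h k n → ℤP.+-assoc (f n) (h n) (k n)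
      }
    ; identity = (λ f n → trans (cong (_+ f n) (cst-zero n)) (ℤP.+-identityˡ (f n)))
               , (λ f n → trans (cong (_+_ (f n)) (cst-zero n)) (ℤP.+-identityʳ (f n)))
    }
  ; comm = λ f h n → ℤP.+-comm (f n) (h n)
  }

⊗-identityˡ : ∀ f → cst (+ 1) ⊗ f ≈ₛ f
⊗-identityˡ f n = trans (cst-⊗ (+ 1) f n) (ℤP.*-identityˡ (f n))

⊗-isCommutativeMonoid : IsCommutativeMonoid _⊗_ (cst (+ 1))
⊗-isCommutativeMonoid = record
  { isMonoid = record
    { isSemigroup = record
      { isMagma = record { isEquivalence = ≈ₛ-isEquivalence ; ∙-cong = ⊗-cong }
      ; assoc   = ⊗-assoc
      }
    ; identity = ⊗-identityˡ , λ f n → trans (⊗-comm f _ n) (⊗-identityˡ f n)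
    }
  ; comm = ⊗-comm
  }

seriesRing : AlmostCommutativeRing _ _
seriesRing = record
  { Carrier = Series
  ; _≈_     = _≈ₛ_
  ; _+_     = _⊕_
  ; _*_     = _⊗_
  ; -_      = ⊝_
  ; 0#      = cst (+ 0)
  ; 1#      = cst (+ 1)
  ; isAlmostCommutativeRing = record
    { isCommutativeSemiring = isCommutativeSemiringˡ record
      { +-isCommutativeMonoid = ⊕-isCommutativeMonoid
      ; *-isCommutativeMonoid = ⊗-isCommutativeMonoid
      ; distribʳ              = ⊗-distribʳ-⊕
      ; zeroˡ                 = λ f n → trans (cst-⊗ (+ 0) f n) (sym (cst-zero n))
      }
    ; -‿cong       = λ f≈ n → cong -_ (f≈ n)
    ; -‿*-distribˡ = ⊝-⊗
    ; -‿+-comm     = λ f h n → sym (ℤP.neg-distrib-+ (f n) (h n))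
    }
  }

cst-homomorphism : ℤ.+-*-rawRing -Raw-AlmostCommutative⟶ seriesRing
cst-homomorphism = record
  { ⟦_⟧    = cst
  ; +-homo = λ { _ _ zero → refl ; _ _ (suc n) → refl }
  ; *-homo = λ { _ _ zero → refl
               ; c d (suc n) → trans (sym (ℤP.*-zeroʳ c)) (sym (cst-⊗ c (cst d) (suc n))) }
  ; -‿homo = λ { _ zero → refl ; _ (suc n) → refl }
  ; 0-homo = λ _ → refl
  ; 1-homo = λ _ → refl
  }

cst-≟ : ∀ c d → Maybe (cst c ≈ₛ cst d)
cst-≟ c d with c ℤ.≟ d
... | yes refl = just λ _ → refl
... | no _     = nothing

open import Algebra.Solver.Ring ℤ.+-*-rawRing seriesRing cst-homomorphism cst-≟
open AlmostCommutativeRing seriesRing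
  using (setoid; +-cong; *-cong; -‿cong; *-identityʳ) renaming (refl to ≈-refl; sym to ≈-sym; trans to ≈-trans)
module ≈-Reasoning = Relation.Binary.Reasoning.Setoid setoid

-- The ring identities below are checked by the solver in the form lhs = rhs + Σ kᵢ (uᵢ - vᵢ);
-- this lemma then discharges each relation uᵢ = vᵢ.
absorb-relation : ∀ {u v} y k → u ≈ₛ v → y ⊕ k ⊗ (u ⊖ v) ≈ₛ y
absorb-relation {u} {v} y k u≈v = begin
  y ⊕ k ⊗ (u ⊖ v)  ≈⟨ +-cong (≈-refl {y}) (*-cong (≈-refl {k}) (+-cong u≈v (≈-refl {⊝ v}))) ⟩
  y ⊕ k ⊗ (v ⊖ v)  ≈⟨ solve 3 (λ y k v → y :+ k :* (v :- v) := y) (λ _ → refl) y k v ⟩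
  y                ∎
  where open ≈-Reasoning

·-as-⊗ : ∀ c f → c · f ≈ₛ cst c ⊗ f
·-as-⊗ c f = ≈-sym (cst-⊗ c f)

cst-suc : ∀ n → cst (+ suc n) ≈ₛ cst (+ 1) ⊕ cst (+ n)
cst-suc n zero    = refl
cst-suc n (suc _) = refl

^ₛ-distrib-⊗ : ∀ f h n → (f ⊗ h) ^ₛ n ≈ₛ f ^ₛ n ⊗ h ^ₛ n
^ₛ-distrib-⊗ f h zero    = ≈-sym (⊗-identityˡ (cst (+ 1)))
^ₛ-distrib-⊗ f h (suc n) = ≈-trans (*-cong (≈-refl {f ⊗ h}) (^ₛ-distrib-⊗ f h n))
  (solve 4 (λ f h F H → (f :* h) :* (F :* H) := (f :* F) :* (h :* H)) (λ _ → refl) f h (f ^ₛ n) (h ^ₛ n))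

shift-X : shift X ≈ₛ cst (+ 1)
shift-X zero    = refl
shift-X (suc _) = refl

X⊗-suc : ∀ f n → (X ⊗ f) (suc n) ≡ f n
X⊗-suc f n = begin
  (X ⊗ f) (suc n)               ≡⟨ ⊗-shiftˡ X f n ⟩
  + 0 + (shift X ⊗ f) n         ≡⟨ ℤP.+-identityˡ _ ⟩
  (shift X ⊗ f) n               ≡⟨ ⊗-cong shift-X (λ _ → refl) n ⟩
  (cst (+ 1) ⊗ f) n             ≡⟨ ⊗-identityˡ f n ⟩
  f n                           ∎
  where open ≡-Reasoning

series-decomposition : ∀ f → f ≈ₛ cst (f 0) ⊕ X ⊗ shift f
series-decomposition f zero    = sym (ℤP.+-identityʳ (f 0))
series-decomposition f (suc n) = sym (trans (ℤP.+-identityˡ _) (X⊗-suc (shift f) n))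

δ-inverse : ∀ {p f} → p ⊗ f ≈ₛ cst (+ 1) → δ f ≈ₛ ⊝ (δ p ⊗ f ^ₛ 2)
δ-inverse {p} {f} pf≈1 = begin
  δ f
    ≈⟨ solve 4 (λ p f δp δf → δf := :- (δp :* f :^ 2) :+ f :* (δp :* f :+ p :* δf :- con (+ 0))
                                        :+ (:- δf) :* (p :* f :- con (+ 1)))
             (λ _ → refl) p f (δ p) (δ f) ⟩
  _ ≈⟨ absorb-relation _ (⊝ δ f) pf≈1 ⟩
  _ ≈⟨ absorb-relation _ f (≈-trans (≈-sym (δ-⊗ p f)) (≈-trans (δ-cong pf≈1) (δ-cst (+ 1)))) ⟩
  ⊝ (δ p ⊗ f ^ₛ 2) ∎
  where open ≈-Reasoning

δ-inverse-^ : ∀ {p f} → p ⊗ f ≈ₛ cst (+ 1) → ∀ n → δ (f ^ₛ n) ≈ₛ cst (+ n) ⊗ (⊝ δ p ⊗ f ^ₛ suc n)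
δ-inverse-^ {p} {f} pf≈1 zero =
  ≈-trans (δ-cst (+ 1)) (solve 2 (λ f δp → con (+ 0) := con (+ 0) :* (:- δp :* f)) (λ _ → refl) (f ^ₛ 1) (δ p))
δ-inverse-^ {p} {f} pf≈1 (suc n) = begin
  δ (f ⊗ f ^ₛ n)
    ≈⟨ δ-⊗ f (f ^ₛ n) ⟩
  δ f ⊗ f ^ₛ n ⊕ f ⊗ δ (f ^ₛ n)
    ≈⟨ +-cong (*-cong (δ-inverse pf≈1) (≈-refl {f ^ₛ n})) (*-cong (≈-refl {f}) (δ-inverse-^ pf≈1 n)) ⟩
  ⊝ (δ p ⊗ f ^ₛ 2) ⊗ f ^ₛ n ⊕ f ⊗ (cst (+ n) ⊗ (⊝ δ p ⊗ f ^ₛ suc n))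
    ≈⟨ solve 4 (λ f F δp c → :- (δp :* f :^ 2) :* F :+ f :* (c :* (:- δp :* (f :* F)))
                              := (con (+ 1) :+ c) :* (:- δp :* (f :* (f :* F))))
             (λ _ → refl) f (f ^ₛ n) (δ p) (cst (+ n)) ⟩
  (cst (+ 1) ⊕ cst (+ n)) ⊗ (⊝ δ p ⊗ f ^ₛ suc (suc n))
    ≈⟨ *-cong (≈-sym (cst-suc n)) (≈-refl {⊝ δ p ⊗ f ^ₛ suc (suc n)}) ⟩
  cst (+ suc n) ⊗ (⊝ δ p ⊗ f ^ₛ suc (suc n)) ∎
  where open ≈-Reasoning

-- Agreement of initial coefficients

infix 4 _≈[<_]_
_≈[<_]_ : Series → ℕ → Series → Set
f ≈[< m ] h = ∀ i → i < m → f i ≡ h i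

≈⇒≈[<] : ∀ {f h m} → f ≈ₛ h → f ≈[< m ] h
≈⇒≈[<] f≈h i _ = f≈h i

≈[<]⇒≈ : ∀ {f h} → (∀ m → f ≈[< m ] h) → f ≈ₛ h
≈[<]⇒≈ f≈h n = f≈h (suc n) n ℕP.≤-refl

≈[<]-extend : ∀ {f h m} → f ≈[< m ] h → f m ≡ h m → f ≈[< suc m ] h
≈[<]-extend {m = m} f≈h fm≡hm i (s≤s i≤m) with ℕP.m≤n⇒m<n∨m≡n i≤m
... | inj₁ i<m  = f≈h i i<m
... | inj₂ refl = fm≡hm

≈[<]-weaken : ∀ {f h m m′} → m′ ≤ m → f ≈[< m ] h → f ≈[< m′ ] h
≈[<]-weaken m′≤m f≈h i i<m′ = f≈h i (ℕP.<-≤-trans i<m′ m′≤m)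

⊕-≈[<] : ∀ {f f′ h h′ m} → f ≈[< m ] f′ → h ≈[< m ] h′ → f ⊕ h ≈[< m ] f′ ⊕ h′
⊕-≈[<] f≈ h≈ i i<m = cong₂ _+_ (f≈ i i<m) (h≈ i i<m)

⊝-≈[<] : ∀ {f f′ m} → f ≈[< m ] f′ → ⊝ f ≈[< m ] ⊝ f′
⊝-≈[<] f≈ i i<m = cong -_ (f≈ i i<m)

convUpTo-≈[<] : ∀ {f f′ h h′ n} → f ≈[< suc n ] f′ → h ≈[< suc n ] h′ →
                ∀ k → k ≤ n → convUpTo f h n k ≡ convUpTo f′ h′ n k
convUpTo-≈[<] {n = n} f≈ h≈ zero    _   = cong₂ _*_ (f≈ 0 (s≤s z≤n)) (h≈ n ℕP.≤-refl)
convUpTo-≈[<] {n = n} f≈ h≈ (suc k) k<n =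
  cong₂ _+_ (convUpTo-≈[<] f≈ h≈ k (ℕP.<⇒≤ k<n))
            (cong₂ _*_ (f≈ (suc k) (s≤s k<n)) (h≈ (n ∸ suc k) (s≤s (ℕP.m∸n≤m n (suc k)))))

⊗-≈[<] : ∀ {f f′ h h′ m} → f ≈[< m ] f′ → h ≈[< m ] h′ → f ⊗ h ≈[< m ] f′ ⊗ h′
⊗-≈[<] f≈ h≈ n n<m = convUpTo-≈[<] (≈[<]-weaken n<m f≈) (≈[<]-weaken n<m h≈) n ℕP.≤-refl

^-≈[<] : ∀ {f f′ m} → f ≈[< m ] f′ → ∀ k → f ^ₛ k ≈[< m ] f′ ^ₛ k
^-≈[<] f≈ zero    _ _ = refl
^-≈[<] f≈ (suc k)     = ⊗-≈[<] f≈ (^-≈[<] f≈ k)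

X⊗-≈[<] : ∀ {f h m} → f ≈[< m ] h → X ⊗ f ≈[< suc m ] X ⊗ h
X⊗-≈[<]         f≈h zero    _         = refl
X⊗-≈[<] {f} {h} f≈h (suc i) (s≤s i<m) = trans (X⊗-suc f i) (trans (f≈h i i<m) (sym (X⊗-suc h i)))

X⊗-≈[<]′ : ∀ {f h m} → f ≈[< m ] h → X ⊗ f ≈[< m ] X ⊗ h
X⊗-≈[<]′ {m = m} f≈h = ≈[<]-weaken (ℕP.n≤1+n m) (X⊗-≈[<] f≈h)

Contractive : (Series → Series) → Set
Contractive T = ∀ {m f h} → f ≈[< m ] h → T f ≈[< suc m ] T h

module _ {T : Series → Series} (contractive : Contractive T) where

  fixedPoint-unique : ∀ {f h} → f ≈ₛ T f → h ≈ₛ T h → f ≈ₛ h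
  fixedPoint-unique {f} {h} f≈Tf h≈Th = ≈[<]⇒≈ agree
    where
    agree : ∀ m → f ≈[< m ] h
    agree zero    _ ()
    agree (suc m) i i≤m = trans (f≈Tf i) (trans (contractive (agree m) i i≤m) (sym (h≈Th i)))

  iterateFrom0 : ℕ → Series
  iterateFrom0 zero    = cst (+ 0)
  iterateFrom0 (suc k) = T (iterateFrom0 k)

  iterateFrom0-step : ∀ k → iterateFrom0 k ≈[< k ] iterateFrom0 (suc k)
  iterateFrom0-step zero    _ ()
  iterateFrom0-step (suc k) = contractive (iterateFrom0-step k)

  fixedPoint : Series
  fixedPoint n = iterateFrom0 (suc n) n

  fixedPoint-≈[<] : ∀ n → fixedPoint ≈[< n ] iterateFrom0 n
  fixedPoint-≈[<] zero    _ ()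
  fixedPoint-≈[<] (suc n) =
    ≈[<]-extend (λ i i<n → trans (fixedPoint-≈[<] n i i<n) (iterateFrom0-step n i i<n)) refl

  fixedPoint-isFixed : fixedPoint ≈ₛ T fixedPoint
  fixedPoint-isFixed n = sym (contractive (fixedPoint-≈[<] n) n ℕP.≤-refl)

-- Writing u = 1 + X u′, both f and 0 are fixed points of the contraction h ↦ - X u′ h.
unit-⊗-cancel : ∀ {u f} → u 0 ≡ + 1 → u ⊗ f ≈ₛ cst (+ 0) → f ≈ₛ cst (+ 0)
unit-⊗-cancel {u} {f} u₀≡1 uf≈0 = fixedPoint-unique contractive f≈Tf 0≈T0
  where
  open ≈-Reasoning
  T : Series → Series
  T h = ⊝ (X ⊗ (shift u ⊗ h))

  contractive : Contractive T
  contractive h≈ = ⊝-≈[<] (X⊗-≈[<] (⊗-≈[<] (≈⇒≈[<] ≈-refl) h≈))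

  u≈1+Xu′ : u ≈ₛ cst (+ 1) ⊕ X ⊗ shift u
  u≈1+Xu′ = ≈-trans (series-decomposition u)
                    (+-cong (λ n → cong (λ c → cst c n) u₀≡1) (≈-refl {X ⊗ shift u}))

  f≈Tf : f ≈ₛ T f
  f≈Tf = begin
    f   ≈⟨ solve 4 (λ f u u′ x → f := :- (x :* (u′ :* f)) :+ (:- f) :* (u :- (con (+ 1) :+ x :* u′))
                                                         :+ con (+ 1) :* (u :* f :- con (+ 0)))
                   (λ _ → refl) f u (shift u) X ⟩
    _   ≈⟨ absorb-relation _ (cst (+ 1)) uf≈0 ⟩
    _   ≈⟨ absorb-relation _ (⊝ f) u≈1+Xu′ ⟩
    T f ∎

  0≈T0 : cst (+ 0) ≈ₛ T (cst (+ 0))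
  0≈T0 = solve 2 (λ u′ x → con (+ 0) := :- (x :* (u′ :* con (+ 0)))) (λ _ → refl) (shift u) X

-- The diagonals of the powers of Φ

Φ : Series
Φ = invOneMinusX ⊗ invOneMinusX²

P : Series
P = (cst (+ 1) ⊖ X) ⊗ (cst (+ 1) ⊖ X ⊗ X)

geometric : (cst (+ 1) ⊖ X) ⊗ invOneMinusX ≈ₛ cst (+ 1)
geometric = ≈-trans (solve 2 (λ x i → (con (+ 1) :- x) :* i := i :- x :* i) (λ _ → refl) X invOneMinusX)
                    coefficients
  where
  coefficients : invOneMinusX ⊖ X ⊗ invOneMinusX ≈ₛ cst (+ 1)
  coefficients zero    = refl
  coefficients (suc n) = cong (λ c → + 1 + - c) (X⊗-suc invOneMinusX n)

geometric² : (cst (+ 1) ⊖ X ⊗ X) ⊗ invOneMinusX² ≈ₛ cst (+ 1)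
geometric² =
  ≈-trans (solve 2 (λ x i → (con (+ 1) :- x :* x) :* i := i :- x :* (x :* i)) (λ _ → refl) X I) coefficients
  where
  I : Series
  I = invOneMinusX²

  coefficients : I ⊖ X ⊗ (X ⊗ I) ≈ₛ cst (+ 1)
  coefficients zero          = refl
  coefficients (suc zero)    = cong (λ c → + 0 + - c) (X⊗-suc (X ⊗ I) 0)
  coefficients (suc (suc n)) =
    trans (cong (λ c → I n + - c) (trans (X⊗-suc (X ⊗ I) (suc n)) (X⊗-suc I n))) (ℤP.+-inverseʳ (I n))

P⊗Φ : P ⊗ Φ ≈ₛ cst (+ 1)
P⊗Φ = begin
  P ⊗ Φ
    ≈⟨ solve 3 (λ x i j → ((con (+ 1) :- x) :* (con (+ 1) :- x :* x)) :* (i :* j)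
                          := ((con (+ 1) :- x) :* i) :* ((con (+ 1) :- x :* x) :* j))
             (λ _ → refl) X invOneMinusX invOneMinusX² ⟩
  ((cst (+ 1) ⊖ X) ⊗ invOneMinusX) ⊗ ((cst (+ 1) ⊖ X ⊗ X) ⊗ invOneMinusX²)
    ≈⟨ *-cong geometric geometric² ⟩
  cst (+ 1) ⊗ cst (+ 1)
    ≈⟨ ⊗-identityˡ (cst (+ 1)) ⟩
  cst (+ 1) ∎
  where open ≈-Reasoning

Φ-recurrence : ∀ N → Φ ^ₛ suc N ≈ₛ Φ ^ₛ N ⊕ X ⊗ (Φ ^ₛ suc N ⊕ X ⊗ (Φ ^ₛ suc N ⊖ X ⊗ Φ ^ₛ suc N))
Φ-recurrence N = begin
  Φ ^ₛ suc N
    ≈⟨ solve 3 (λ x φ F → φ :* F := F :+ x :* (φ :* F :+ x :* (φ :* F :- x :* (φ :* F)))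
                                       :+ F :* ((con (+ 1) :- x) :* (con (+ 1) :- x :* x) :* φ :- con (+ 1)))
             (λ _ → refl) X Φ (Φ ^ₛ N) ⟩
  _ ≈⟨ absorb-relation _ (Φ ^ₛ N) P⊗Φ ⟩
  Φ ^ₛ N ⊕ X ⊗ (Φ ^ₛ suc N ⊕ X ⊗ (Φ ^ₛ suc N ⊖ X ⊗ Φ ^ₛ suc N)) ∎
  where open ≈-Reasoning

δ-P : ⊝ δ P ≈ₛ X ⊗ (cst (+ 1) ⊕ X ⊗ (cst (+ 2) ⊖ cst (+ 3) ⊗ X))
δ-P = begin
  ⊝ δ P
    ≈⟨ -‿cong (δ-⊗ (cst (+ 1) ⊖ X) (cst (+ 1) ⊖ X ⊗ X)) ⟩
  ⊝ (δ (cst (+ 1) ⊖ X) ⊗ (cst (+ 1) ⊖ X ⊗ X) ⊕ (cst (+ 1) ⊖ X) ⊗ δ (cst (+ 1) ⊖ X ⊗ X))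
    ≈⟨ -‿cong (+-cong (*-cong (≈-trans (δ-cst⊖ (+ 1) X) (-‿cong δ-X)) (≈-refl {cst (+ 1) ⊖ X ⊗ X}))
                      (*-cong (≈-refl {cst (+ 1) ⊖ X})
                              (≈-trans (δ-cst⊖ (+ 1) (X ⊗ X))
                                       (-‿cong (≈-trans (δ-⊗ X X) (+-cong (*-cong δ-X (≈-refl {X}))
                                                                          (*-cong (≈-refl {X}) δ-X))))))) ⟩
  ⊝ (⊝ X ⊗ (cst (+ 1) ⊖ X ⊗ X) ⊕ (cst (+ 1) ⊖ X) ⊗ ⊝ (X ⊗ X ⊕ X ⊗ X))
    ≈⟨ solve 1 (λ x → :- (:- x :* (con (+ 1) :- x :* x) :+ (con (+ 1) :- x) :* (:- (x :* x :+ x :* x)))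
                      := x :* (con (+ 1) :+ x :* (con (+ 2) :- con (+ 3) :* x)))
             (λ _ → refl) X ⟩
  X ⊗ (cst (+ 1) ⊕ X ⊗ (cst (+ 2) ⊖ cst (+ 3) ⊗ X)) ∎
  where open ≈-Reasoning

diagonal : (ℕ → Series) → Series
diagonal F n = F n n

diagonal-cong : ∀ {F G} → (∀ n → F n ≈ₛ G n) → diagonal F ≈ₛ diagonal G
diagonal-cong F≈G n = F≈G n n

diagonal-X⊗ : ∀ (F : ℕ → Series) k → diagonal (λ n → X ⊗ F (k ℕ.+ n)) ≈ₛ X ⊗ diagonal (λ n → F (suc k ℕ.+ n))
diagonal-X⊗ F k zero    = refl
diagonal-X⊗ F k (suc n) = begin
  (X ⊗ F (k ℕ.+ suc n)) (suc n)          ≡⟨ X⊗-suc (F (k ℕ.+ suc n)) n ⟩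
  F (k ℕ.+ suc n) n                      ≡⟨ cong (λ e → F e n) (ℕP.+-suc k n) ⟩
  F (suc k ℕ.+ n) n                      ≡⟨ X⊗-suc (diagonal (λ n → F (suc k ℕ.+ n))) n ⟨
  (X ⊗ diagonal (λ n → F (suc k ℕ.+ n))) (suc n) ∎
  where open ≡-Reasoning

diagonal-cst⊗ : ∀ c F → diagonal (λ n → cst c ⊗ F n) ≈ₛ cst c ⊗ diagonal F
diagonal-cst⊗ c F n = trans (cst-⊗ c (F n) n) (sym (cst-⊗ c (diagonal F) n))

diagonal-weighted : ∀ F → diagonal (λ n → cst (+ n) ⊗ F n) ≈ₛ δ (diagonal F)
diagonal-weighted F n = cst-⊗ (+ n) (F n) n

Λ : ℕ → Series
Λ k = diagonal (λ n → Φ ^ₛ (k ℕ.+ n))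

recurrenceTail : (ℕ → Series) → ℕ → Series
recurrenceTail F k = F (2 ℕ.+ k) ⊕ X ⊗ (F (3 ℕ.+ k) ⊖ X ⊗ F (4 ℕ.+ k))

Recurrent : (ℕ → Series) → Set
Recurrent F = ∀ k → F (suc k) ≈ₛ F k ⊕ X ⊗ recurrenceTail F k

recurrent-unique : ∀ {F G} → Recurrent F → Recurrent G → F 0 ≈ₛ G 0 → ∀ k → F k ≈ₛ G k
recurrent-unique {F} {G} F-rec G-rec F₀≈G₀ k = ≈[<]⇒≈ (λ m → agree m k)
  where
  agree : ∀ m k → F k ≈[< m ] G k
  agree zero    k _ ()
  agree (suc m) k = ≈[<]-extend (agree m k) (top k)
    where
    top : ∀ k → F k m ≡ G k m
    top zero    = F₀≈G₀ m
    top (suc k) = begin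
      F (suc k) m                            ≡⟨ F-rec k m ⟩
      F k m + (X ⊗ recurrenceTail F k) m     ≡⟨ cong₂ _+_ (top k) (X⊗-≈[<] tail m ℕP.≤-refl) ⟩
      G k m + (X ⊗ recurrenceTail G k) m     ≡⟨ G-rec k m ⟨
      G (suc k) m                            ∎
      where
      open ≡-Reasoning
      tail : recurrenceTail F k ≈[< m ] recurrenceTail G k
      tail = ⊕-≈[<] (agree m (2 ℕ.+ k))
                    (X⊗-≈[<]′ (⊕-≈[<] (agree m (3 ℕ.+ k)) (⊝-≈[<] (X⊗-≈[<]′ (agree m (4 ℕ.+ k))))))

Λ-recurrent : Recurrent Λ
Λ-recurrent k = begin
  Λ (suc k)                                    ≈⟨ diagonal-cong (λ n → Φ-recurrence (k ℕ.+ n)) ⟩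
  Λ k ⊕ diagonal (λ n → X ⊗ R₁ (suc k ℕ.+ n))  ≈⟨ +-cong (≈-refl {Λ k}) (diagonal-X⊗ R₁ (suc k)) ⟩
  Λ k ⊕ X ⊗ diagonal (λ n → R₁ (2 ℕ.+ k ℕ.+ n)) ≈⟨ +-cong (≈-refl {Λ k}) (*-cong (≈-refl {X}) layer₂) ⟩
  Λ k ⊕ X ⊗ recurrenceTail Λ k                 ∎
  where
  open ≈-Reasoning
  R₂ R₁ : ℕ → Series
  R₂ e = Φ ^ₛ e ⊖ X ⊗ Φ ^ₛ e
  R₁ e = Φ ^ₛ e ⊕ X ⊗ R₂ e

  layer₃ : diagonal (λ n → R₂ (3 ℕ.+ k ℕ.+ n)) ≈ₛ Λ (3 ℕ.+ k) ⊖ X ⊗ Λ (4 ℕ.+ k)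
  layer₃ = +-cong (≈-refl {Λ (3 ℕ.+ k)}) (-‿cong (diagonal-X⊗ (Φ ^ₛ_) (3 ℕ.+ k)))

  layer₂ : diagonal (λ n → R₁ (2 ℕ.+ k ℕ.+ n)) ≈ₛ recurrenceTail Λ k
  layer₂ = +-cong (≈-refl {Λ (2 ℕ.+ k)}) (≈-trans (diagonal-X⊗ R₂ (2 ℕ.+ k)) (*-cong (≈-refl {X}) layer₃))

quartic : Series → Series
quartic s = X ^ₛ 3 ⊗ s ^ₛ 4 ⊖ X ^ₛ 2 ⊗ s ^ₛ 3 ⊖ X ⊗ s ^ₛ 2 ⊕ s ⊖ cst (+ 1)

powers-recurrent : ∀ {s} A → quartic s ≈ₛ cst (+ 0) → Recurrent (λ k → A ⊗ s ^ₛ k)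
powers-recurrent {s} A s-root k = begin
  A ⊗ s ^ₛ suc k
    ≈⟨ solve 4 (λ a S s x → a :* (s :* S)
                  := a :* S :+ x :* (a :* (s :* (s :* S)) :+ x :* (a :* (s :* (s :* (s :* S)))
                                                            :- x :* (a :* (s :* (s :* (s :* (s :* S)))))))
                     :+ (a :* S) :* (x :^ 3 :* s :^ 4 :- x :^ 2 :* s :^ 3 :- x :* s :^ 2 :+ s :- con (+ 1)
                                     :- con (+ 0)))
             (λ _ → refl) A (s ^ₛ k) s X ⟩
  _ ≈⟨ absorb-relation _ (A ⊗ s ^ₛ k) s-root ⟩
  A ⊗ s ^ₛ k ⊕ X ⊗ recurrenceTail (λ k → A ⊗ s ^ₛ k) k ∎
  where open ≈-Reasoning

Λ-powers : ∀ {s} → quartic s ≈ₛ cst (+ 0) → ∀ k → Λ k ≈ₛ Λ 0 ⊗ s ^ₛ k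
Λ-powers s-root = recurrent-unique Λ-recurrent (powers-recurrent (Λ 0) s-root) (≈-sym (*-identityʳ (Λ 0)))

lagrangeTail : (ℕ → Series) → Series
lagrangeTail F = F 2 ⊕ X ⊗ (cst (+ 2) ⊗ F 3 ⊖ X ⊗ (cst (+ 3) ⊗ F 4))

lagrangeTail-cong : ∀ {F G} → (∀ k → F k ≈ₛ G k) → lagrangeTail F ≈ₛ lagrangeTail G
lagrangeTail-cong F≈G =
  +-cong (F≈G 2) (*-cong (≈-refl {X}) (+-cong (*-cong (≈-refl {cst (+ 2)}) (F≈G 3))
                                              (-‿cong (*-cong (≈-refl {X}) (*-cong (≈-refl {cst (+ 3)}) (F≈G 4))))))

Λ-lagrange : Λ 0 ≈ₛ cst (+ 1) ⊕ X ⊗ lagrangeTail Λ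
Λ-lagrange = δ-injective refl (begin
  δ (Λ 0)                                             ≈⟨ diagonal-cong (δ-inverse-^ P⊗Φ) ⟩
  diagonal (λ n → cst (+ n) ⊗ (⊝ δ P ⊗ Φ ^ₛ suc n))    ≈⟨ diagonal-weighted (λ n → ⊝ δ P ⊗ Φ ^ₛ suc n) ⟩
  δ (diagonal (λ n → ⊝ δ P ⊗ Φ ^ₛ suc n))              ≈⟨ δ-cong (diagonal-cong (λ n → expand (Φ ^ₛ suc n))) ⟩
  δ (diagonal (λ n → X ⊗ L₁ (1 ℕ.+ n)))               ≈⟨ δ-cong layer₁ ⟩
  δ (X ⊗ lagrangeTail Λ)                              ≈⟨ δ-cst⊕ (+ 1) (X ⊗ lagrangeTail Λ) ⟨
  δ (cst (+ 1) ⊕ X ⊗ lagrangeTail Λ)                  ∎)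
  where
  open ≈-Reasoning
  L₂ L₁ : ℕ → Series
  L₂ e = cst (+ 2) ⊗ Φ ^ₛ e ⊖ X ⊗ (cst (+ 3) ⊗ Φ ^ₛ e)
  L₁ e = Φ ^ₛ e ⊕ X ⊗ L₂ e

  expand : ∀ f → ⊝ δ P ⊗ f ≈ₛ X ⊗ (f ⊕ X ⊗ (cst (+ 2) ⊗ f ⊖ X ⊗ (cst (+ 3) ⊗ f)))
  expand f = ≈-trans (*-cong δ-P (≈-refl {f}))
    (solve 2 (λ x f → x :* (con (+ 1) :+ x :* (con (+ 2) :- con (+ 3) :* x)) :* f
                      := x :* (f :+ x :* (con (+ 2) :* f :- x :* (con (+ 3) :* f))))
           (λ _ → refl) X f)

  layer₂ : diagonal (λ n → L₂ (3 ℕ.+ n)) ≈ₛ cst (+ 2) ⊗ Λ 3 ⊖ X ⊗ (cst (+ 3) ⊗ Λ 4)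
  layer₂ = +-cong (diagonal-cst⊗ (+ 2) (λ n → Φ ^ₛ (3 ℕ.+ n)))
                  (-‿cong (≈-trans (diagonal-X⊗ (λ e → cst (+ 3) ⊗ Φ ^ₛ e) 3)
                                   (*-cong (≈-refl {X}) (diagonal-cst⊗ (+ 3) (λ n → Φ ^ₛ (4 ℕ.+ n))))))

  layer₁ : diagonal (λ n → X ⊗ L₁ (1 ℕ.+ n)) ≈ₛ X ⊗ lagrangeTail Λ
  layer₁ = ≈-trans (diagonal-X⊗ L₁ 1)
                   (*-cong (≈-refl {X}) (+-cong (≈-refl {Λ 2})
                                                (≈-trans (diagonal-X⊗ L₂ 2) (*-cong (≈-refl {X}) layer₂))))

-- The closed form and the algebraic equation of g

Λ₀-inverse : ∀ {s} → quartic s ≈ₛ cst (+ 0) → Λ 0 ⊗ (cst (+ 1) ⊖ X ⊗ lagrangeTail (s ^ₛ_)) ≈ₛ cst (+ 1)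
Λ₀-inverse {s} s-root = begin
  Λ 0 ⊗ (cst (+ 1) ⊖ X ⊗ lagrangeTail (s ^ₛ_))
    ≈⟨ solve 3 (λ a s x →
                  a :* (con (+ 1) :- x :* (s :^ 2 :+ x :* (con (+ 2) :* s :^ 3 :- x :* (con (+ 3) :* s :^ 4))))
                  := con (+ 1) :+ con (+ 1) :* (a :- (con (+ 1) :+ x :* (a :* s :^ 2
                       :+ x :* (con (+ 2) :* (a :* s :^ 3) :- x :* (con (+ 3) :* (a :* s :^ 4)))))))
             (λ _ → refl) (Λ 0) s X ⟩
  _ ≈⟨ absorb-relation (cst (+ 1)) (cst (+ 1)) Λ₀-expansion ⟩
  cst (+ 1) ∎
  where
  open ≈-Reasoning
  Λ₀-expansion : Λ 0 ≈ₛ cst (+ 1) ⊕ X ⊗ lagrangeTail (λ k → Λ 0 ⊗ s ^ₛ k)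
  Λ₀-expansion = ≈-trans Λ-lagrange
    (+-cong (≈-refl {cst (+ 1)}) (*-cong (≈-refl {X}) (lagrangeTail-cong (Λ-powers s-root))))

denominator numerator : Series → Series
denominator s = cst (+ 1) ⊖ X ⊗ s ⊖ cst (+ 4) ⊗ (X ^ₛ 2 ⊗ s ^ₛ 2)
numerator   s = cst (+ 1) ⊖ s ^ₛ 2 ⊗ X ^ₛ 2

Λ₀-closed-form : ∀ {s} → quartic s ≈ₛ cst (+ 0) → Λ 0 ⊗ denominator s ≈ₛ numerator s
Λ₀-closed-form {s} s-root = begin
  Λ 0 ⊗ denominator s
    ≈⟨ solve 3 (λ a s x →
         let w = x :* s
             D = con (+ 1) :- x :* s :- con (+ 4) :* (x :^ 2 :* s :^ 2)
             N = con (+ 1) :- s :^ 2 :* x :^ 2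
             E = con (+ 1) :- x :* (s :^ 2 :+ x :* (con (+ 2) :* s :^ 3 :- x :* (con (+ 3) :* s :^ 4)))
             wP′ = :- w :- con (+ 2) :* w :^ 2 :+ con (+ 3) :* w :^ 3
             quartic = x :^ 3 :* s :^ 4 :- x :^ 2 :* s :^ 3 :- x :* s :^ 2 :+ s :- con (+ 1)
         in a :* D := N :+ N :* (a :* E :- con (+ 1))
                        :+ (:- (a :* (s :* N :* wP′ :+ D :- N :* E))) :* (quartic :- con (+ 0)))
             (λ _ → refl) (Λ 0) s X ⟩
  _ ≈⟨ absorb-relation _ _ s-root ⟩
  _ ≈⟨ absorb-relation _ _ (Λ₀-inverse s-root) ⟩
  numerator s ∎
  where open ≈-Reasoning

g≈Λ₀ : g ≈ₛ Λ 0
g≈Λ₀ n = sym (^ₛ-distrib-⊗ invOneMinusX invOneMinusX² n n)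

g-closed-form : ∀ {s} → quartic s ≈ₛ cst (+ 0) → g ⊗ denominator s ≈ₛ numerator s
g-closed-form {s} s-root = ≈-trans (*-cong g≈Λ₀ (≈-refl {denominator s})) (Λ₀-closed-form s-root)

gPolynomial : Series → Series
gPolynomial y = (cst (+ 256) ⊗ X ^ₛ 2 ⊕ cst (+ 107) ⊗ X ⊖ cst (+ 32)) ⊗ y ^ₛ 4
              ⊕ (cst (- + 256) ⊗ X ^ₛ 2 ⊖ cst (+ 107) ⊗ X ⊕ cst (+ 32)) ⊗ y ^ₛ 3
              ⊕ cst (+ 12) ⊗ (X ⊗ (cst (+ 8) ⊗ X ⊕ cst (+ 3))) ⊗ y ^ₛ 2
              ⊖ cst (+ 4) ⊗ (X ⊗ (cst (+ 4) ⊗ X ⊕ cst (+ 1))) ⊗ y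
              ⊕ X ^ₛ 2

gPolynomial-root : ∀ {s y} → quartic s ≈ₛ cst (+ 0) → y ⊗ denominator s ≈ₛ numerator s →
                   gPolynomial y ≈ₛ cst (+ 0)
gPolynomial-root {s} {y} s-root y-closed = unit-⊗-cancel {u = denominator s ^ₛ 4} refl (begin
  denominator s ^ₛ 4 ⊗ gPolynomial y
    ≈⟨ solve 3 (λ x s y →
         -- quotient = (D⁴ Q(y) - Σ qᵢ Nⁱ D⁴⁻ⁱ) / (y D - N), and Σ qᵢ Nⁱ D⁴⁻ⁱ = x · cofactor · quartic
         let w  = x :* s
             D  = con (+ 1) :- x :* s :- con (+ 4) :* (x :^ 2 :* s :^ 2)
             N  = con (+ 1) :- s :^ 2 :* x :^ 2
             q₀ = x :^ 2
             q₁ = con (- + 4) :* (x :* (con (+ 4) :* x :+ con (+ 1)))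
             q₂ = con (+ 12) :* (x :* (con (+ 8) :* x :+ con (+ 3)))
             q₃ = con (- + 256) :* x :^ 2 :- con (+ 107) :* x :+ con (+ 32)
             q₄ = con (+ 256) :* x :^ 2 :+ con (+ 107) :* x :- con (+ 32)
             u  = y :* D
             quotient = q₁ :* D :^ 3 :+ q₂ :* D :^ 2 :* (u :+ N)
                        :+ q₃ :* D :* (u :^ 2 :+ u :* N :+ N :^ 2)
                        :+ q₄ :* (u :^ 3 :+ u :^ 2 :* N :+ u :* N :^ 2 :+ N :^ 3)
             cofactor = con (- + 32) :- con (+ 128) :* w :- con (+ 64) :* w :^ 2 :+ con (+ 128) :* w :^ 3
                        :+ con (+ 96) :* w :^ 4
                        :+ x :* (con (- + 81) :- con (+ 108) :* w :- con (+ 54) :* w :^ 2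
                                 :- con (+ 12) :* w :^ 3 :- w :^ 4)
             quartic = x :^ 3 :* s :^ 4 :- x :^ 2 :* s :^ 3 :- x :* s :^ 2 :+ s :- con (+ 1)
         in D :^ 4 :* (q₄ :* y :^ 4 :+ q₃ :* y :^ 3 :+ q₂ :* y :^ 2
                       :- con (+ 4) :* (x :* (con (+ 4) :* x :+ con (+ 1))) :* y :+ q₀)
              := con (+ 0) :+ quotient :* (y :* D :- N) :+ (x :* cofactor) :* (quartic :- con (+ 0)))
             (λ _ → refl) X s y ⟩
  _ ≈⟨ absorb-relation _ _ s-root ⟩
  _ ≈⟨ absorb-relation _ _ y-closed ⟩
  cst (+ 0) ∎)
  where open ≈-Reasoning

denominator-scalar : ∀ s → cst (+ 1) ⊖ X ⊗ s ⊖ (+ 4) · (X ^ₛ 2 ⊗ s ^ₛ 2) ≈ₛ denominator s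
denominator-scalar s = +-cong (≈-refl {cst (+ 1) ⊖ X ⊗ s}) (-‿cong (·-as-⊗ (+ 4) (X ^ₛ 2 ⊗ s ^ₛ 2)))

gPolynomial-scalars : ∀ y →
  ((+ 256) · (X ^ₛ 2) ⊕ (+ 107) · X ⊖ cst (+ 32)) ⊗ (y ^ₛ 4)
  ⊕ ((- (+ 256)) · (X ^ₛ 2) ⊖ (+ 107) · X ⊕ cst (+ 32)) ⊗ (y ^ₛ 3)
  ⊕ (+ 12) · (X ⊗ ((+ 8) · X ⊕ cst (+ 3))) ⊗ (y ^ₛ 2)
  ⊖ (+ 4) · (X ⊗ ((+ 4) · X ⊕ cst (+ 1))) ⊗ y
  ⊕ (X ^ₛ 2)
  ≈ₛ gPolynomial y
gPolynomial-scalars y =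
  +-cong (+-cong (+-cong (+-cong
    (*-cong (+-cong (+-cong (·-as-⊗ (+ 256) (X ^ₛ 2)) (·-as-⊗ (+ 107) X)) (≈-refl {⊝ cst (+ 32)}))
            (≈-refl {y ^ₛ 4}))
    (*-cong (+-cong (+-cong (·-as-⊗ (- + 256) (X ^ₛ 2)) (-‿cong (·-as-⊗ (+ 107) X))) (≈-refl {cst (+ 32)}))
            (≈-refl {y ^ₛ 3})))
    (*-cong (≈-trans (·-as-⊗ (+ 12) (X ⊗ ((+ 8) · X ⊕ cst (+ 3))))
                     (*-cong (≈-refl {cst (+ 12)})
                             (*-cong (≈-refl {X}) (+-cong (·-as-⊗ (+ 8) X) (≈-refl {cst (+ 3)})))))
            (≈-refl {y ^ₛ 2})))
    (-‿cong (*-cong (≈-trans (·-as-⊗ (+ 4) (X ⊗ ((+ 4) · X ⊕ cst (+ 1))))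
                             (*-cong (≈-refl {cst (+ 4)})
                                     (*-cong (≈-refl {X}) (+-cong (·-as-⊗ (+ 4) X) (≈-refl {cst (+ 1)})))))
                    (≈-refl {y}))))
    (≈-refl {X ^ₛ 2})

quarticStep : Series → Series
quarticStep t = cst (+ 1) ⊕ X ⊗ (t ^ₛ 2 ⊕ X ⊗ (t ^ₛ 3 ⊖ X ⊗ t ^ₛ 4))

quarticStep-contractive : Contractive quarticStep
quarticStep-contractive t≈ =
  ⊕-≈[<] (≈⇒≈[<] (≈-refl {cst (+ 1)}))
         (X⊗-≈[<] (⊕-≈[<] (^-≈[<] t≈ 2) (X⊗-≈[<]′ (⊕-≈[<] (^-≈[<] t≈ 3) (⊝-≈[<] (X⊗-≈[<]′ (^-≈[<] t≈ 4)))))))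

quarticRoot : Series
quarticRoot = fixedPoint quarticStep-contractive

quarticRoot-root : quartic quarticRoot ≈ₛ cst (+ 0)
quarticRoot-root = begin
  quartic quarticRoot
    ≈⟨ solve 2 (λ s x → x :^ 3 :* s :^ 4 :- x :^ 2 :* s :^ 3 :- x :* s :^ 2 :+ s :- con (+ 1)
                         := con (+ 0) :+ con (- + 1) :* (con (+ 1) :+ x :* (s :^ 2 :+ x :* (s :^ 3 :- x :* s :^ 4))
                                                         :- s))
             (λ _ → refl) quarticRoot X ⟩
  _ ≈⟨ absorb-relation (cst (+ 0)) (cst (- + 1)) (≈-sym (fixedPoint-isFixed quarticStep-contractive)) ⟩
  cst (+ 0) ∎
  where open ≈-Reasoning

mainTheorem1 :
    Σ Series (λ s → (s 0 ≡ + 1) × ((X ^ₛ 3) ⊗ (s ^ₛ 4) ⊖ (X ^ₛ 2) ⊗ (s ^ₛ 3) ⊖ X ⊗ (s ^ₛ 2) ⊕ s ⊖ cst (+ 1) ≈ₛ cst (+ 0)))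
    × ((s : Series) → s 0 ≡ + 1
        → (X ^ₛ 3) ⊗ (s ^ₛ 4) ⊖ (X ^ₛ 2) ⊗ (s ^ₛ 3) ⊖ X ⊗ (s ^ₛ 2) ⊕ s ⊖ cst (+ 1) ≈ₛ cst (+ 0)
        → g ⊗ (cst (+ 1) ⊖ X ⊗ s ⊖ (+ 4) · ((X ^ₛ 2) ⊗ (s ^ₛ 2))) ≈ₛ cst (+ 1) ⊖ (s ^ₛ 2) ⊗ (X ^ₛ 2))
    × ((+ 256) · (X ^ₛ 2) ⊕ (+ 107) · X ⊖ cst (+ 32)) ⊗ (g ^ₛ 4)
        ⊕ ((- (+ 256)) · (X ^ₛ 2) ⊖ (+ 107) · X ⊕ cst (+ 32)) ⊗ (g ^ₛ 3)
        ⊕ (+ 12) · (X ⊗ ((+ 8) · X ⊕ cst (+ 3))) ⊗ (g ^ₛ 2)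
        ⊖ (+ 4) · (X ⊗ ((+ 4) · X ⊕ cst (+ 1))) ⊗ g
        ⊕ (X ^ₛ 2)
        ≈ₛ cst (+ 0)
mainTheorem1 =
    (quarticRoot , refl , quarticRoot-root)
  , (λ s _ s-root → ≈-trans (*-cong (≈-refl {g}) (denominator-scalar s)) (g-closed-form s-root))
  , ≈-trans (gPolynomial-scalars g) (gPolynomial-root quarticRoot-root (g-closed-form quarticRoot-root))
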